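{- Let $r\geq 1$. (1) If $A\in GL(r,2)$ has order $2^l$ for some $l\geq 0$, then $(I+A)^r=0$. (2) The order of any element of a regular subgroup of $GA(r,2)$ is at most $2^{\lfloor \log_2 r\rfloor+1}$.
   Context: $GA(r,2)$ is the affine group of $F_2^r$: elements are pairs $(a,A)$ with $a\in F_2^r$, $A\in GL(r,2)$, acting on $F_2^r$ by $v\mapsto a+Av$, with composition of maps as group operation. A subgroup of $GA(r,2)$ is regular if it acts transitively on $F_2^r$ and has order $2^r$. $I$ denotes the $r\times r$ identity matrix. -}

module Defs where

open import Data.Bool using (Bool; true; false; _xor_; _∧_)
open import Data.Nat using (ℕ; zero; suc; _<_; _≤_)
open import Data.Fin using (Fin)
open import Data.Vec using (Vec; tabulate; lookup; replicate; foldr)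
open import Data.Product using (Σ; _×_; _,_; proj₁; proj₂; ∃)
open import Data.List using (List; length)
open import Data.List.Membership.Propositional using (_∈_)
open import Data.List.Relation.Unary.Unique.Propositional using (Unique)
open import Relation.Binary.PropositionalEquality using (_≡_)
open import Relation.Nullary using (¬_)
open import Function.Bundles using (_⇔_)

-- The field F₂ = Bool with  + = xor,  · = ∧.
F₂ : Set
F₂ = Bool

-- Column vectors in F₂^r and r×r matrices over F₂ (row-major: M i j).
Vect : ℕ → Set
Vect r = Vec F₂ r

Mat : ℕ → Set
Mat r = Vec (Vec F₂ r) r

Σ₂ : ∀ {n} → (Fin n → F₂) → F₂
Σ₂ f = foldr _ _xor_ false (tabulate f)

0ᵥ : ∀ {r} → Vect r
0ᵥ = replicate _ false

_+ᵥ_ : ∀ {r} → Vect r → Vect r → Vect r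
u +ᵥ v = tabulate (λ i → lookup u i xor lookup v i)

0ₘ : ∀ {r} → Mat r
0ₘ = replicate _ (replicate _ false)

Iₘ : ∀ {r} → Mat r
Iₘ = tabulate (λ i → tabulate (λ j → isEq i j))
  where
  open import Data.Fin using (_≟_)
  open import Relation.Nullary.Decidable using (⌊_⌋)
  isEq : ∀ {r} → Fin r → Fin r → F₂
  isEq i j = ⌊ i ≟ j ⌋

_+ₘ_ : ∀ {r} → Mat r → Mat r → Mat r
A +ₘ B = tabulate (λ i → tabulate (λ j → lookup (lookup A i) j xor lookup (lookup B i) j))

_*ₘ_ : ∀ {r} → Mat r → Mat r → Mat r
A *ₘ B = tabulate (λ i → tabulate (λ j → Σ₂ (λ k → lookup (lookup A i) k ∧ lookup (lookup B k) j)))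

_·ᵥ_ : ∀ {r} → Mat r → Vect r → Vect r
A ·ᵥ v = tabulate (λ i → Σ₂ (λ k → lookup (lookup A i) k ∧ lookup v k))

_^ₘ_ : ∀ {r} → Mat r → ℕ → Mat r
A ^ₘ zero = Iₘ
A ^ₘ suc n = A *ₘ (A ^ₘ n)

InGL : ∀ {r} → Mat r → Set
InGL {r} A = Σ (Mat r) λ B → (A *ₘ B ≡ Iₘ) × (B *ₘ A ≡ Iₘ)

HasOrderMat : ∀ {r} → Mat r → ℕ → Set
HasOrderMat A n = (0 < n) × (A ^ₘ n ≡ Iₘ) × (∀ m → 0 < m → m < n → ¬ (A ^ₘ m ≡ Iₘ))

-- Affine maps (a , A) : v ↦ a + A v  (A is required to be in GL for membership in GA)
Aff : ℕ → Set
Aff r = Vect r × Mat r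

InGA : ∀ {r} → Aff r → Set
InGA (a , A) = InGL A

act : ∀ {r} → Aff r → Vect r → Vect r
act (a , A) v = a +ᵥ (A ·ᵥ v)

-- group operation = composition of maps: (g ∘ h)(v) = g (h v)
_∘ₐ_ : ∀ {r} → Aff r → Aff r → Aff r
(a , A) ∘ₐ (b , B) = (a +ᵥ (A ·ᵥ b)) , (A *ₘ B)

eₐ : ∀ {r} → Aff r
eₐ = 0ᵥ , Iₘ

_^ₐ_ : ∀ {r} → Aff r → ℕ → Aff r
g ^ₐ zero = eₐ
g ^ₐ suc n = g ∘ₐ (g ^ₐ n)

HasOrderAff : ∀ {r} → Aff r → ℕ → Set
HasOrderAff g n = (0 < n) × (g ^ₐ n ≡ eₐ) × (∀ m → 0 < m → m < n → ¬ (g ^ₐ m ≡ eₐ))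

IsSubgroupGA : ∀ {r} → (Aff r → Set) → Set
IsSubgroupGA {r} H =
  (∀ g → H g → InGA g) ×
  H eₐ ×
  (∀ g h → H g → H h → H (g ∘ₐ h)) ×
  (∀ g → H g → Σ (Aff r) λ h → H h × (g ∘ₐ h ≡ eₐ) × (h ∘ₐ g ≡ eₐ))

HasCard : ∀ {r} → (Aff r → Set) → ℕ → Set
HasCard {r} H n = Σ (List (Aff r)) λ xs → Unique xs × (length xs ≡ n) × (∀ g → H g ⇔ (g ∈ xs))

Transitive : ∀ {r} → (Aff r → Set) → Set
Transitive {r} H = ∀ (v w : Vect r) → Σ (Aff r) λ g → H g × (act g v ≡ w)

IsRegularSubgroupGA : ∀ {r} → (Aff r → Set) → Set
IsRegularSubgroupGA {r} H = IsSubgroupGA H × Transitive H × HasCard H (2 Data.Nat.^ r)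
  where import Data.Nat

module Submission where

-- (1) Over F₂, Frobenius gives (I + A)^(2^l) = I + A^(2^l), so A^(2^l) = I
--     makes N = I + A nilpotent.  A nilpotent r×r matrix has N^r = 0:
--     otherwise some v has height h + 1 > r (N^(h+1) v = 0 ≠ N^h v), so the
--     Krylov vectors v, N v, …, N^r v are linearly independent and their
--     2^(r+1) combinations are distinct vectors of F₂^r, against pigeonhole.
-- (2) For g = (a , A) in a subgroup H of order 2^r, left multiplication by
--     g is a free cyclic action on H with orbits of size ord g, so ord g
--     divides 2^r; hence A^(2^r) = I and (I + A)^r = 0 by (1).  Repeated
--     squaring gives g^(2^k) = ((I + A)^(2^k - 1) a , A^(2^k)), trivial once
--     2^k > r; take k = ⌊log₂ r⌋ + 1.

open import Defs
open import Data.Nat using (ℕ; zero; suc; _+_; _*_; _^_; _∸_; _≤_; _<_; z≤n; s≤s)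
import Data.Nat.Properties as ℕ
open import Data.Nat.Divisibility using (_∣_; divides; _∣0; ∣-refl; ∣m∣n⇒∣m+n)
open import Data.Nat.Induction using (<-wellFounded)
open import Data.Nat.Logarithm using (⌊log₂_⌋; ⌊log₂⌋-mono-≤; ⌊log₂[2^n]⌋≡n)
open import Data.Bool using (Bool; true; false; _xor_; _∧_; if_then_else_)
import Data.Bool as Bool
open import Data.Bool.Properties
  using (xor-assoc; xor-same; xor-identityʳ; ∧-comm; ∧-assoc; ∧-zeroʳ;
         ∧-distribˡ-xor; ∧-distribʳ-xor; xor-∧-commutativeRing)
open import Data.Fin using (Fin; zero; suc; _≟_; combine; remQuot; toℕ; fromℕ<)
open import Data.Fin.Properties
  using (pigeonhole; combine-remQuot; remQuot-combine; <⇒≢; toℕ<n; toℕ-fromℕ<; toℕ-injective)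
open import Data.Vec using (Vec; []; _∷_; tabulate; lookup; replicate)
open import Data.Vec.Properties using (≡-dec; lookup∘tabulate; tabulate∘lookup; tabulate-cong; lookup-replicate)
open import Data.Product using (Σ; _×_; _,_; proj₁; proj₂)
open import Data.Product.Properties using () renaming (≡-dec to ×-≟)
open import Data.Sum using ([_,_]′)
open import Data.List using (List; []; _∷_; length; filter; _++_)
import Data.List as List
open import Data.List.Properties using (length-++; length-tabulate)
open import Data.List.Relation.Unary.Any using (here)
open import Data.List.Membership.Propositional using (_∈_)
open import Data.List.Membership.Propositional.Properties
  using (∈-filter⁺; ∈-filter⁻; ∈-++⁺ˡ; ∈-++⁺ʳ; ∈-++⁻; ∈-tabulate⁺; ∈-tabulate⁻)
open import Data.List.Membership.Propositional.Properties.WithK using (unique∧set⇒bag)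
open import Data.List.Relation.Unary.Unique.Propositional using (Unique)
open import Data.List.Relation.Unary.Unique.Propositional.Properties using (++⁺; filter⁺; tabulate⁺)
open import Data.List.Relation.Binary.BagAndSetEquality using (∼bag⇒↭)
open import Data.List.Relation.Binary.Permutation.Propositional.Properties using (↭-length)
open import Function.Bundles using (_⇔_; mk⇔; Equivalence)
open import Induction.WellFounded using (Acc; acc)
open import Relation.Nullary using (¬_; ¬?; Dec; yes; no; contradiction)
open import Relation.Nullary.Decidable using (⌊_⌋)
open import Relation.Binary.Definitions using (DecidableEquality; tri<; tri≈; tri>)
open import Relation.Binary.PropositionalEquality
open import Algebra.Bundles using (CommutativeRing)
open CommutativeRing xor-∧-commutativeRing using (semiring)
open import Algebra.Properties.Semiring.Sum semiring
  using (sum; sum-cong-≗; sum-replicate-zero; ∑-distrib-+; ∑-comm; *-distribˡ-sum; *-distribʳ-sum)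
open ≡-Reasoning

-- The sum Σ₂ of Defs is the library's finite sum in the ring (F₂, xor, ∧);
-- after this lemma all sums are manipulated with the library's sum laws.
Σ₂≡sum : ∀ {n} (f : Fin n → F₂) → Σ₂ f ≡ sum f
Σ₂≡sum {zero} f = refl
Σ₂≡sum {suc n} f = cong (f zero xor_) (Σ₂≡sum (λ k → f (suc k)))

δ : ∀ {n} → Fin n → Fin n → F₂
δ i j = ⌊ i ≟ j ⌋

δ-sym : ∀ {n} (i j : Fin n) → δ i j ≡ δ j i
δ-sym i j with i ≟ j | j ≟ i
... | yes _    | yes _    = refl
... | no _     | no _     = refl
... | yes i≡j  | no j≢i   = contradiction (sym i≡j) j≢i
... | no i≢j   | yes j≡i  = contradiction (sym j≡i) i≢j

δ-suc : ∀ {n} (i j : Fin n) → δ (suc i) (suc j) ≡ δ i j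
δ-suc i j with i ≟ j
... | yes _ = refl
... | no _  = refl

sum-δˡ : ∀ {n} (f : Fin n → F₂) i → sum (λ k → δ i k ∧ f k) ≡ f i
sum-δˡ {suc n} f zero =
  trans (cong (f zero xor_) (sum-replicate-zero n)) (xor-identityʳ (f zero))
sum-δˡ {suc n} f (suc i) =
  trans (sum-cong-≗ (λ k → cong (_∧ f (suc k)) (δ-suc i k))) (sum-δˡ (λ k → f (suc k)) i)

sum-δʳ : ∀ {n} (f : Fin n → F₂) j → sum (λ k → f k ∧ δ k j) ≡ f j
sum-δʳ f j = trans (sum-cong-≗ (λ k → trans (∧-comm (f k) _) (cong (_∧ f k) (δ-sym k j))))
                   (sum-δˡ f j)

ent : ∀ {r} → Mat r → Fin r → Fin r → F₂
ent M i j = lookup (lookup M i) j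

vec-ext : ∀ {A : Set} {r} {u v : Vec A r} → (∀ i → lookup u i ≡ lookup v i) → u ≡ v
vec-ext {u = u} {v} h = trans (sym (tabulate∘lookup u)) (trans (tabulate-cong h) (tabulate∘lookup v))

mat-ext : ∀ {r} {M N : Mat r} → (∀ i j → ent M i j ≡ ent N i j) → M ≡ N
mat-ext h = vec-ext (λ i → vec-ext (h i))

ent-tabulate : ∀ {r} (f : Fin r → Fin r → F₂) i j → ent (tabulate (λ i → tabulate (f i))) i j ≡ f i j
ent-tabulate f i j rewrite lookup∘tabulate (λ i → tabulate (f i)) i = lookup∘tabulate (f i) j

ent-I : ∀ {r} (i j : Fin r) → ent Iₘ i j ≡ δ i j
ent-I = ent-tabulate δ

ent-0 : ∀ {r} (i j : Fin r) → ent (0ₘ {r}) i j ≡ false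
ent-0 {r} i j rewrite lookup-replicate i (replicate r false) = lookup-replicate j false

ent-+ : ∀ {r} (A B : Mat r) i j → ent (A +ₘ B) i j ≡ ent A i j xor ent B i j
ent-+ A B = ent-tabulate _

ent-* : ∀ {r} (A B : Mat r) i j → ent (A *ₘ B) i j ≡ sum (λ k → ent A i k ∧ ent B k j)
ent-* A B i j = trans (ent-tabulate _ i j) (Σ₂≡sum (λ k → ent A i k ∧ ent B k j))

lookup-0 : ∀ {r} (i : Fin r) → lookup (0ᵥ {r}) i ≡ false
lookup-0 i = lookup-replicate i false

lookup-+ : ∀ {r} (u v : Vect r) i → lookup (u +ᵥ v) i ≡ lookup u i xor lookup v i
lookup-+ u v = lookup∘tabulate _

lookup-· : ∀ {r} (A : Mat r) (v : Vect r) i → lookup (A ·ᵥ v) i ≡ sum (λ k → ent A i k ∧ lookup v k)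
lookup-· A v i = trans (lookup∘tabulate _ i) (Σ₂≡sum (λ k → ent A i k ∧ lookup v k))

xor-cancelˡ : ∀ x {y z} → x xor y ≡ x xor z → y ≡ z
xor-cancelˡ false eq = eq
xor-cancelˡ true {false} {false} eq = refl
xor-cancelˡ true {true}  {true}  eq = refl
xor-cancelˡ true {false} {true}  ()
xor-cancelˡ true {true}  {false} ()

xor≡false : ∀ {x y} → x xor y ≡ false → x ≡ y
xor≡false {false} eq = sym eq
xor≡false {true} {true} eq = refl
xor≡false {true} {false} ()

+ᵥ-assoc : ∀ {r} (u v w : Vect r) → (u +ᵥ v) +ᵥ w ≡ u +ᵥ (v +ᵥ w)
+ᵥ-assoc u v w = vec-ext λ i → begin
  lookup ((u +ᵥ v) +ᵥ w) i
    ≡⟨ trans (lookup-+ (u +ᵥ v) w i) (cong (_xor lookup w i) (lookup-+ u v i)) ⟩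
  (lookup u i xor lookup v i) xor lookup w i
    ≡⟨ xor-assoc (lookup u i) (lookup v i) (lookup w i) ⟩
  lookup u i xor (lookup v i xor lookup w i)
    ≡⟨ sym (trans (lookup-+ u (v +ᵥ w) i) (cong (lookup u i xor_) (lookup-+ v w i))) ⟩
  lookup (u +ᵥ (v +ᵥ w)) i ∎

+ᵥ-identityˡ : ∀ {r} (v : Vect r) → 0ᵥ +ᵥ v ≡ v
+ᵥ-identityˡ v = vec-ext λ i → trans (lookup-+ 0ᵥ v i) (cong (_xor lookup v i) (lookup-0 i))

+ᵥ-identityʳ : ∀ {r} (v : Vect r) → v +ᵥ 0ᵥ ≡ v
+ᵥ-identityʳ v = vec-ext λ i →
  trans (lookup-+ v 0ᵥ i) (trans (cong (lookup v i xor_) (lookup-0 i)) (xor-identityʳ _))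

+ᵥ-cancelˡ : ∀ {r} (u : Vect r) {v w} → u +ᵥ v ≡ u +ᵥ w → v ≡ w
+ᵥ-cancelˡ u {v} {w} eq = vec-ext λ i →
  xor-cancelˡ (lookup u i) (trans (sym (lookup-+ u v i)) (trans (cong (λ x → lookup x i) eq) (lookup-+ u w i)))

·ᵥ-distrib : ∀ {r} (A : Mat r) (u w : Vect r) → A ·ᵥ (u +ᵥ w) ≡ (A ·ᵥ u) +ᵥ (A ·ᵥ w)
·ᵥ-distrib A u w = vec-ext λ i → begin
  lookup (A ·ᵥ (u +ᵥ w)) i
    ≡⟨ trans (lookup-· A (u +ᵥ w) i) (sum-cong-≗ λ k →
         trans (cong (ent A i k ∧_) (lookup-+ u w k)) (∧-distribˡ-xor (ent A i k) (lookup u k) (lookup w k))) ⟩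
  sum (λ k → (ent A i k ∧ lookup u k) xor (ent A i k ∧ lookup w k))
    ≡⟨ ∑-distrib-+ (λ k → ent A i k ∧ lookup u k) _ ⟩
  sum (λ k → ent A i k ∧ lookup u k) xor sum (λ k → ent A i k ∧ lookup w k)
    ≡⟨ sym (trans (lookup-+ (A ·ᵥ u) (A ·ᵥ w) i) (cong₂ _xor_ (lookup-· A u i) (lookup-· A w i))) ⟩
  lookup ((A ·ᵥ u) +ᵥ (A ·ᵥ w)) i ∎

·ᵥ-zero : ∀ {r} (A : Mat r) → A ·ᵥ 0ᵥ ≡ 0ᵥ
·ᵥ-zero {r} A = vec-ext λ i → begin
  lookup (A ·ᵥ 0ᵥ) i
    ≡⟨ trans (lookup-· A 0ᵥ i) (sum-cong-≗ λ k → trans (cong (ent A i k ∧_) (lookup-0 k)) (∧-zeroʳ _)) ⟩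
  sum {r} (λ _ → false)
    ≡⟨ sum-replicate-zero r ⟩
  false
    ≡⟨ sym (lookup-0 i) ⟩
  lookup 0ᵥ i ∎

0ₘ-·ᵥ : ∀ {r} (v : Vect r) → 0ₘ ·ᵥ v ≡ 0ᵥ
0ₘ-·ᵥ {r} v = vec-ext λ i → begin
  lookup (0ₘ ·ᵥ v) i    ≡⟨ trans (lookup-· 0ₘ v i) (sum-cong-≗ λ k → cong (_∧ lookup v k) (ent-0 i k)) ⟩
  sum {r} (λ _ → false) ≡⟨ sum-replicate-zero r ⟩
  false                 ≡⟨ sym (lookup-0 i) ⟩
  lookup 0ᵥ i           ∎

Iₘ-·ᵥ : ∀ {r} (v : Vect r) → Iₘ ·ᵥ v ≡ v
Iₘ-·ᵥ v = vec-ext λ i →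
  trans (lookup-· Iₘ v i) (trans (sum-cong-≗ λ k → cong (_∧ lookup v k) (ent-I i k)) (sum-δˡ (lookup v) i))

+ₘ-·ᵥ : ∀ {r} (A B : Mat r) (v : Vect r) → (A +ₘ B) ·ᵥ v ≡ (A ·ᵥ v) +ᵥ (B ·ᵥ v)
+ₘ-·ᵥ A B v = vec-ext λ i → begin
  lookup ((A +ₘ B) ·ᵥ v) i
    ≡⟨ trans (lookup-· (A +ₘ B) v i) (sum-cong-≗ λ k →
         trans (cong (_∧ lookup v k) (ent-+ A B i k)) (∧-distribʳ-xor (lookup v k) (ent A i k) (ent B i k))) ⟩
  sum (λ k → (ent A i k ∧ lookup v k) xor (ent B i k ∧ lookup v k))
    ≡⟨ ∑-distrib-+ (λ k → ent A i k ∧ lookup v k) _ ⟩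
  sum (λ k → ent A i k ∧ lookup v k) xor sum (λ k → ent B i k ∧ lookup v k)
    ≡⟨ sym (trans (lookup-+ (A ·ᵥ v) (B ·ᵥ v) i) (cong₂ _xor_ (lookup-· A v i) (lookup-· B v i))) ⟩
  lookup ((A ·ᵥ v) +ᵥ (B ·ᵥ v)) i ∎

sum-∧-assoc : ∀ {r} (a : Fin r → F₂) (b : Fin r → Fin r → F₂) (c : Fin r → F₂) →
  sum (λ k → sum (λ l → a l ∧ b l k) ∧ c k) ≡ sum (λ l → a l ∧ sum (λ k → b l k ∧ c k))
sum-∧-assoc a b c = begin
  sum (λ k → sum (λ l → a l ∧ b l k) ∧ c k)   ≡⟨ sum-cong-≗ (λ k → *-distribʳ-sum (c k) (λ l → a l ∧ b l k)) ⟩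
  sum (λ k → sum (λ l → (a l ∧ b l k) ∧ c k)) ≡⟨ ∑-comm (λ k l → (a l ∧ b l k) ∧ c k) ⟩
  sum (λ l → sum (λ k → (a l ∧ b l k) ∧ c k)) ≡⟨ sum-cong-≗ (λ l → sum-cong-≗ (λ k → ∧-assoc (a l) (b l k) (c k))) ⟩
  sum (λ l → sum (λ k → a l ∧ (b l k ∧ c k))) ≡⟨ sum-cong-≗ (λ l → sym (*-distribˡ-sum (a l) (λ k → b l k ∧ c k))) ⟩
  sum (λ l → a l ∧ sum (λ k → b l k ∧ c k))   ∎

*ₘ-·ᵥ : ∀ {r} (A B : Mat r) (v : Vect r) → (A *ₘ B) ·ᵥ v ≡ A ·ᵥ (B ·ᵥ v)
*ₘ-·ᵥ A B v = vec-ext λ i → begin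
  lookup ((A *ₘ B) ·ᵥ v) i
    ≡⟨ trans (lookup-· (A *ₘ B) v i) (sum-cong-≗ λ k → cong (_∧ lookup v k) (ent-* A B i k)) ⟩
  sum (λ k → sum (λ l → ent A i l ∧ ent B l k) ∧ lookup v k)
    ≡⟨ sum-∧-assoc (ent A i) (ent B) (lookup v) ⟩
  sum (λ l → ent A i l ∧ sum (λ k → ent B l k ∧ lookup v k))
    ≡⟨ sym (trans (lookup-· A (B ·ᵥ v) i) (sum-cong-≗ λ l → cong (ent A i l ∧_) (lookup-· B v l))) ⟩
  lookup (A ·ᵥ (B ·ᵥ v)) i ∎

-- A matrix is determined by its action: M eⱼ is the j-th column of M, for
-- the standard basis vector eⱼ.  This reduces the multiplicative matrix laws
-- to the laws of the action.
basis : ∀ {r} → Fin r → Vect r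
basis j = tabulate (δ j)

lookup-·-basis : ∀ {r} (M : Mat r) i j → lookup (M ·ᵥ basis j) i ≡ ent M i j
lookup-·-basis M i j = trans (lookup-· M (basis j) i)
  (trans (sum-cong-≗ λ k → cong (ent M i k ∧_) (trans (lookup∘tabulate (δ j) k) (δ-sym j k)))
         (sum-δʳ (ent M i) j))

action-ext : ∀ {r} {M N : Mat r} → (∀ v → M ·ᵥ v ≡ N ·ᵥ v) → M ≡ N
action-ext {M = M} {N} same = mat-ext λ i j → begin
  ent M i j                ≡⟨ sym (lookup-·-basis M i j) ⟩
  lookup (M ·ᵥ basis j) i  ≡⟨ cong (λ v → lookup v i) (same (basis j)) ⟩
  lookup (N ·ᵥ basis j) i  ≡⟨ lookup-·-basis N i j ⟩
  ent N i j                ∎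

*ₘ-assoc : ∀ {r} (A B C : Mat r) → (A *ₘ B) *ₘ C ≡ A *ₘ (B *ₘ C)
*ₘ-assoc A B C = action-ext λ v → begin
  ((A *ₘ B) *ₘ C) ·ᵥ v   ≡⟨ *ₘ-·ᵥ (A *ₘ B) C v ⟩
  (A *ₘ B) ·ᵥ (C ·ᵥ v)   ≡⟨ *ₘ-·ᵥ A B (C ·ᵥ v) ⟩
  A ·ᵥ (B ·ᵥ (C ·ᵥ v))   ≡⟨ cong (A ·ᵥ_) (sym (*ₘ-·ᵥ B C v)) ⟩
  A ·ᵥ ((B *ₘ C) ·ᵥ v)   ≡⟨ sym (*ₘ-·ᵥ A (B *ₘ C) v) ⟩
  (A *ₘ (B *ₘ C)) ·ᵥ v   ∎

*ₘ-identityˡ : ∀ {r} (A : Mat r) → Iₘ *ₘ A ≡ A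
*ₘ-identityˡ A = action-ext λ v → trans (*ₘ-·ᵥ Iₘ A v) (Iₘ-·ᵥ (A ·ᵥ v))

*ₘ-identityʳ : ∀ {r} (A : Mat r) → A *ₘ Iₘ ≡ A
*ₘ-identityʳ A = action-ext λ v → trans (*ₘ-·ᵥ A Iₘ v) (cong (A ·ᵥ_) (Iₘ-·ᵥ v))

*ₘ-zeroʳ : ∀ {r} (A : Mat r) → A *ₘ 0ₘ ≡ 0ₘ
*ₘ-zeroʳ A = action-ext λ v → begin
  (A *ₘ 0ₘ) ·ᵥ v   ≡⟨ *ₘ-·ᵥ A 0ₘ v ⟩
  A ·ᵥ (0ₘ ·ᵥ v)   ≡⟨ cong (A ·ᵥ_) (0ₘ-·ᵥ v) ⟩
  A ·ᵥ 0ᵥ          ≡⟨ ·ᵥ-zero A ⟩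
  0ᵥ               ≡⟨ sym (0ₘ-·ᵥ v) ⟩
  0ₘ ·ᵥ v          ∎

*ₘ-distribˡ : ∀ {r} (A B C : Mat r) → A *ₘ (B +ₘ C) ≡ (A *ₘ B) +ₘ (A *ₘ C)
*ₘ-distribˡ A B C = action-ext λ v → begin
  (A *ₘ (B +ₘ C)) ·ᵥ v                    ≡⟨ *ₘ-·ᵥ A (B +ₘ C) v ⟩
  A ·ᵥ ((B +ₘ C) ·ᵥ v)                    ≡⟨ cong (A ·ᵥ_) (+ₘ-·ᵥ B C v) ⟩
  A ·ᵥ ((B ·ᵥ v) +ᵥ (C ·ᵥ v))             ≡⟨ ·ᵥ-distrib A (B ·ᵥ v) (C ·ᵥ v) ⟩
  (A ·ᵥ (B ·ᵥ v)) +ᵥ (A ·ᵥ (C ·ᵥ v))      ≡⟨ sym (cong₂ _+ᵥ_ (*ₘ-·ᵥ A B v) (*ₘ-·ᵥ A C v)) ⟩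
  ((A *ₘ B) ·ᵥ v) +ᵥ ((A *ₘ C) ·ᵥ v)      ≡⟨ sym (+ₘ-·ᵥ (A *ₘ B) (A *ₘ C) v) ⟩
  ((A *ₘ B) +ₘ (A *ₘ C)) ·ᵥ v             ∎

*ₘ-distribʳ : ∀ {r} (A B C : Mat r) → (A +ₘ B) *ₘ C ≡ (A *ₘ C) +ₘ (B *ₘ C)
*ₘ-distribʳ A B C = action-ext λ v → begin
  ((A +ₘ B) *ₘ C) ·ᵥ v                    ≡⟨ *ₘ-·ᵥ (A +ₘ B) C v ⟩
  (A +ₘ B) ·ᵥ (C ·ᵥ v)                    ≡⟨ +ₘ-·ᵥ A B (C ·ᵥ v) ⟩
  (A ·ᵥ (C ·ᵥ v)) +ᵥ (B ·ᵥ (C ·ᵥ v))      ≡⟨ sym (cong₂ _+ᵥ_ (*ₘ-·ᵥ A C v) (*ₘ-·ᵥ B C v)) ⟩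
  ((A *ₘ C) ·ᵥ v) +ᵥ ((B *ₘ C) ·ᵥ v)      ≡⟨ sym (+ₘ-·ᵥ (A *ₘ C) (B *ₘ C) v) ⟩
  ((A *ₘ C) +ₘ (B *ₘ C)) ·ᵥ v             ∎

+ₘ-assoc : ∀ {r} (A B C : Mat r) → (A +ₘ B) +ₘ C ≡ A +ₘ (B +ₘ C)
+ₘ-assoc A B C = mat-ext λ i j → begin
  ent ((A +ₘ B) +ₘ C) i j
    ≡⟨ trans (ent-+ (A +ₘ B) C i j) (cong (_xor ent C i j) (ent-+ A B i j)) ⟩
  (ent A i j xor ent B i j) xor ent C i j
    ≡⟨ xor-assoc (ent A i j) (ent B i j) (ent C i j) ⟩
  ent A i j xor (ent B i j xor ent C i j)
    ≡⟨ sym (trans (ent-+ A (B +ₘ C) i j) (cong (ent A i j xor_) (ent-+ B C i j))) ⟩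
  ent (A +ₘ (B +ₘ C)) i j ∎

+ₘ-identityˡ : ∀ {r} (A : Mat r) → 0ₘ +ₘ A ≡ A
+ₘ-identityˡ A = mat-ext λ i j → trans (ent-+ 0ₘ A i j) (cong (_xor ent A i j) (ent-0 i j))

+ₘ-self : ∀ {r} (A : Mat r) → A +ₘ A ≡ 0ₘ
+ₘ-self A = mat-ext λ i j → trans (ent-+ A A i j) (trans (xor-same (ent A i j)) (sym (ent-0 i j)))

+ₘ≡0⇒≡ : ∀ {r} {A B : Mat r} → A +ₘ B ≡ 0ₘ → A ≡ B
+ₘ≡0⇒≡ {A = A} {B} eq = mat-ext λ i j →
  xor≡false (trans (sym (ent-+ A B i j)) (trans (cong (λ M → ent M i j) eq) (ent-0 i j)))

^ₘ-+ : ∀ {r} (A : Mat r) m n → A ^ₘ (m + n) ≡ (A ^ₘ m) *ₘ (A ^ₘ n)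
^ₘ-+ A zero n = sym (*ₘ-identityˡ _)
^ₘ-+ A (suc m) n = trans (cong (A *ₘ_) (^ₘ-+ A m n)) (sym (*ₘ-assoc A (A ^ₘ m) (A ^ₘ n)))

^ₘ-double : ∀ {r} (A : Mat r) m → A ^ₘ (2 * m) ≡ (A ^ₘ m) *ₘ (A ^ₘ m)
^ₘ-double A m = trans (cong (λ k → A ^ₘ (m + k)) (ℕ.+-identityʳ m)) (^ₘ-+ A m m)

^ₘ-multiple : ∀ {r} (A : Mat r) {n m} → A ^ₘ n ≡ Iₘ → n ∣ m → A ^ₘ m ≡ Iₘ
^ₘ-multiple A {n} Aⁿ≡I (divides q refl) = go q
  where
  go : ∀ q → A ^ₘ (q * n) ≡ Iₘ
  go zero = refl
  go (suc q) = trans (^ₘ-+ A n (q * n)) (trans (cong₂ _*ₘ_ Aⁿ≡I (go q)) (*ₘ-identityˡ Iₘ))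

^ₘ-vanishes : ∀ {r} (N : Mat r) {m p} → N ^ₘ m ≡ 0ₘ → m ≤ p → N ^ₘ p ≡ 0ₘ
^ₘ-vanishes N {m} {p} Nᵐ≡0 m≤p = begin
  N ^ₘ p                        ≡⟨ cong (N ^ₘ_) (sym (ℕ.m∸n+n≡m m≤p)) ⟩
  N ^ₘ ((p ∸ m) + m)            ≡⟨ ^ₘ-+ N (p ∸ m) m ⟩
  (N ^ₘ (p ∸ m)) *ₘ (N ^ₘ m)    ≡⟨ cong ((N ^ₘ (p ∸ m)) *ₘ_) Nᵐ≡0 ⟩
  (N ^ₘ (p ∸ m)) *ₘ 0ₘ          ≡⟨ *ₘ-zeroʳ (N ^ₘ (p ∸ m)) ⟩
  0ₘ                            ∎

-- In characteristic 2 the cross terms of (I + B)² cancel.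
square-I+ : ∀ {r} (B : Mat r) → (Iₘ +ₘ B) *ₘ (Iₘ +ₘ B) ≡ Iₘ +ₘ (B *ₘ B)
square-I+ B = begin
  (Iₘ +ₘ B) *ₘ (Iₘ +ₘ B)                ≡⟨ *ₘ-distribʳ Iₘ B (Iₘ +ₘ B) ⟩
  (Iₘ *ₘ (Iₘ +ₘ B)) +ₘ (B *ₘ (Iₘ +ₘ B)) ≡⟨ cong₂ _+ₘ_ (*ₘ-identityˡ (Iₘ +ₘ B)) (*ₘ-distribˡ B Iₘ B) ⟩
  (Iₘ +ₘ B) +ₘ ((B *ₘ Iₘ) +ₘ (B *ₘ B))  ≡⟨ cong (λ X → (Iₘ +ₘ B) +ₘ (X +ₘ (B *ₘ B))) (*ₘ-identityʳ B) ⟩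
  (Iₘ +ₘ B) +ₘ (B +ₘ (B *ₘ B))          ≡⟨ +ₘ-assoc Iₘ B (B +ₘ (B *ₘ B)) ⟩
  Iₘ +ₘ (B +ₘ (B +ₘ (B *ₘ B)))          ≡⟨ cong (Iₘ +ₘ_) (sym (+ₘ-assoc B B (B *ₘ B))) ⟩
  Iₘ +ₘ ((B +ₘ B) +ₘ (B *ₘ B))          ≡⟨ cong (λ X → Iₘ +ₘ (X +ₘ (B *ₘ B))) (+ₘ-self B) ⟩
  Iₘ +ₘ (0ₘ +ₘ (B *ₘ B))                ≡⟨ cong (Iₘ +ₘ_) (+ₘ-identityˡ (B *ₘ B)) ⟩
  Iₘ +ₘ (B *ₘ B)                        ∎

frobenius : ∀ {r} (A : Mat r) l → (Iₘ +ₘ A) ^ₘ (2 ^ l) ≡ Iₘ +ₘ (A ^ₘ (2 ^ l))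
frobenius A zero = trans (*ₘ-identityʳ (Iₘ +ₘ A)) (cong (Iₘ +ₘ_) (sym (*ₘ-identityʳ A)))
frobenius A (suc l) = begin
  (Iₘ +ₘ A) ^ₘ (2 * 2 ^ l)                            ≡⟨ ^ₘ-double (Iₘ +ₘ A) (2 ^ l) ⟩
  ((Iₘ +ₘ A) ^ₘ (2 ^ l)) *ₘ ((Iₘ +ₘ A) ^ₘ (2 ^ l))    ≡⟨ cong₂ _*ₘ_ (frobenius A l) (frobenius A l) ⟩
  (Iₘ +ₘ (A ^ₘ (2 ^ l))) *ₘ (Iₘ +ₘ (A ^ₘ (2 ^ l)))    ≡⟨ square-I+ (A ^ₘ (2 ^ l)) ⟩
  Iₘ +ₘ ((A ^ₘ (2 ^ l)) *ₘ (A ^ₘ (2 ^ l)))            ≡⟨ cong (Iₘ +ₘ_) (sym (^ₘ-double A (2 ^ l))) ⟩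
  Iₘ +ₘ (A ^ₘ (2 * 2 ^ l))                            ∎

unipotent : ∀ {r} (A : Mat r) l → A ^ₘ (2 ^ l) ≡ Iₘ → (Iₘ +ₘ A) ^ₘ (2 ^ l) ≡ 0ₘ
unipotent A l A²ˡ≡I = trans (frobenius A l) (trans (cong (Iₘ +ₘ_) A²ˡ≡I) (+ₘ-self Iₘ))

-- Binary encoding F₂^n ≅ Fin (2^n), used to count vectors.
bit : Bool → Fin 2
bit false = zero
bit true  = suc zero

unbit : Fin 2 → Bool
unbit zero       = false
unbit (suc zero) = true

encode : ∀ {n} → Vec Bool n → Fin (2 ^ n)
encode []       = zero
encode (b ∷ v)  = combine (bit b) (encode v)

decode : ∀ {n} → Fin (2 ^ n) → Vec Bool n
decode {zero}  _ = []
decode {suc n} i = unbit (proj₁ (remQuot {2} (2 ^ n) i)) ∷ decode (proj₂ (remQuot {2} (2 ^ n) i))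

decode-encode : ∀ {n} (v : Vec Bool n) → decode (encode v) ≡ v
decode-encode [] = refl
decode-encode {suc n} (b ∷ v) =
  trans (cong (λ p → unbit (proj₁ p) ∷ decode {n} (proj₂ p)) (remQuot-combine {2} {2 ^ n} (bit b) (encode v)))
        (cong₂ _∷_ (unbit-bit b) (decode-encode v))
  where
  unbit-bit : ∀ b → unbit (bit b) ≡ b
  unbit-bit false = refl
  unbit-bit true  = refl

encode-decode : ∀ {n} (i : Fin (2 ^ n)) → encode (decode {n} i) ≡ i
encode-decode {zero} zero = refl
encode-decode {suc n} i =
  trans (cong₂ combine (bit-unbit (proj₁ (remQuot {2} (2 ^ n) i))) (encode-decode {n} (proj₂ (remQuot {2} (2 ^ n) i))))
        (combine-remQuot {2} (2 ^ n) i)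
  where
  bit-unbit : ∀ a → bit (unbit a) ≡ a
  bit-unbit zero       = refl
  bit-unbit (suc zero) = refl

vec-pigeonhole : ∀ {r} (f : Vec Bool (suc r) → Vec Bool r) →
  Σ (Vec Bool (suc r)) λ c → Σ (Vec Bool (suc r)) λ c' → (¬ c ≡ c') × (f c ≡ f c')
vec-pigeonhole {r} f
  with pigeonhole (ℕ.^-monoʳ-< 2 (s≤s (s≤s z≤n)) (ℕ.n<1+n r)) (λ i → encode (f (decode {suc r} i)))
... | i , j , i<j , same-code = decode i , decode j , decode-injective (<⇒≢ i<j) , encode-injective same-code
  where
  decode-injective : ¬ i ≡ j → ¬ decode {suc r} i ≡ decode j
  decode-injective i≢j eq =
    i≢j (trans (sym (encode-decode {suc r} i)) (trans (cong encode eq) (encode-decode {suc r} j)))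
  encode-injective : ∀ {u v : Vec Bool r} → encode u ≡ encode v → u ≡ v
  encode-injective {u} {v} eq = trans (sym (decode-encode u)) (trans (cong decode eq) (decode-encode v))

_•_ : ∀ {r} → F₂ → Vect r → Vect r
b • u = if b then u else 0ᵥ

·ᵥ-• : ∀ {r} (M : Mat r) b (u : Vect r) → M ·ᵥ (b • u) ≡ b • (M ·ᵥ u)
·ᵥ-• M false u = ·ᵥ-zero M
·ᵥ-• M true  u = refl

•-distinct : ∀ {r} {b b'} → ¬ b ≡ b' → (v : Vect r) → b • v ≡ b' • v → v ≡ 0ᵥ
•-distinct {b = false} {false} b≢b' v _ = contradiction refl b≢b'
•-distinct {b = false} {true}  _ v eq = sym eq
•-distinct {b = true}  {false} _ v eq = eq
•-distinct {b = true}  {true}  b≢b' v _ = contradiction refl b≢b'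

-- If N^(j+1) u = 0 but N^j u ≠ 0, the j+1 vectors u, …, N^j u are linearly
-- independent; with j ≥ r this contradicts counting, which bounds the
-- nilpotency index of N by r.
module Krylov {r} (N : Mat r) where

  N^_·_ : ℕ → Vect r → Vect r
  N^ k · v = (N ^ₘ k) ·ᵥ v

  N^-shift : ∀ k v → N^ k · (N ·ᵥ v) ≡ N^ (suc k) · v
  N^-shift k v = begin
    (N ^ₘ k) ·ᵥ (N ·ᵥ v)          ≡⟨ sym (*ₘ-·ᵥ (N ^ₘ k) N v) ⟩
    ((N ^ₘ k) *ₘ N) ·ᵥ v          ≡⟨ cong (λ X → ((N ^ₘ k) *ₘ X) ·ᵥ v) (sym (*ₘ-identityʳ N)) ⟩
    ((N ^ₘ k) *ₘ (N ^ₘ 1)) ·ᵥ v   ≡⟨ cong (_·ᵥ v) (sym (^ₘ-+ N k 1)) ⟩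
    (N ^ₘ (k + 1)) ·ᵥ v           ≡⟨ cong (λ e → (N ^ₘ e) ·ᵥ v) (ℕ.+-comm k 1) ⟩
    (N ^ₘ suc k) ·ᵥ v             ∎

  N^-commute : ∀ k v → N^ k · (N ·ᵥ v) ≡ N ·ᵥ (N^ k · v)
  N^-commute k v = trans (N^-shift k v) (*ₘ-·ᵥ N (N ^ₘ k) v)

  krylov : ∀ {k} → Vec F₂ k → Vect r → Vect r
  krylov []      u = 0ᵥ
  krylov (b ∷ c) u = (b • u) +ᵥ krylov c (N ·ᵥ u)

  krylov-zero : ∀ {k} (c : Vec F₂ k) → krylov c 0ᵥ ≡ 0ᵥ
  krylov-zero [] = refl
  krylov-zero (b ∷ c) = begin
    (b • 0ᵥ) +ᵥ krylov c (N ·ᵥ 0ᵥ)  ≡⟨ cong₂ _+ᵥ_ (•-zero b) (trans (cong (krylov c) (·ᵥ-zero N)) (krylov-zero c)) ⟩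
    0ᵥ +ᵥ 0ᵥ                       ≡⟨ +ᵥ-identityˡ 0ᵥ ⟩
    0ᵥ                             ∎
    where
    •-zero : ∀ b → b • 0ᵥ ≡ 0ᵥ
    •-zero false = refl
    •-zero true  = refl

  krylov-commute : ∀ (M : Mat r) → (∀ v → M ·ᵥ (N ·ᵥ v) ≡ N ·ᵥ (M ·ᵥ v)) →
                   ∀ {k} (c : Vec F₂ k) u → M ·ᵥ krylov c u ≡ krylov c (M ·ᵥ u)
  krylov-commute M comm [] u = ·ᵥ-zero M
  krylov-commute M comm (b ∷ c) u = begin
    M ·ᵥ ((b • u) +ᵥ krylov c (N ·ᵥ u))          ≡⟨ ·ᵥ-distrib M (b • u) (krylov c (N ·ᵥ u)) ⟩
    (M ·ᵥ (b • u)) +ᵥ (M ·ᵥ krylov c (N ·ᵥ u))   ≡⟨ cong₂ _+ᵥ_ (·ᵥ-• M b u) (krylov-commute M comm c (N ·ᵥ u)) ⟩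
    (b • (M ·ᵥ u)) +ᵥ krylov c (M ·ᵥ (N ·ᵥ u))   ≡⟨ cong (λ w → (b • (M ·ᵥ u)) +ᵥ krylov c w) (comm u) ⟩
    (b • (M ·ᵥ u)) +ᵥ krylov c (N ·ᵥ (M ·ᵥ u))   ∎

  leading-term : ∀ j {u} → N^ (suc j) · u ≡ 0ᵥ → ∀ {k} b (c : Vec F₂ k) →
                 N^ j · krylov (b ∷ c) u ≡ b • (N^ j · u)
  leading-term j {u} vanish b c = begin
    N^ j · ((b • u) +ᵥ krylov c (N ·ᵥ u))
      ≡⟨ ·ᵥ-distrib (N ^ₘ j) (b • u) (krylov c (N ·ᵥ u)) ⟩
    (N^ j · (b • u)) +ᵥ (N^ j · krylov c (N ·ᵥ u))
      ≡⟨ cong₂ _+ᵥ_ (·ᵥ-• (N ^ₘ j) b u) (krylov-commute (N ^ₘ j) (N^-commute j) c (N ·ᵥ u)) ⟩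
    (b • (N^ j · u)) +ᵥ krylov c (N^ j · (N ·ᵥ u))
      ≡⟨ cong (λ w → (b • (N^ j · u)) +ᵥ krylov c w) (trans (N^-shift j u) vanish) ⟩
    (b • (N^ j · u)) +ᵥ krylov c 0ᵥ
      ≡⟨ cong ((b • (N^ j · u)) +ᵥ_) (krylov-zero c) ⟩
    (b • (N^ j · u)) +ᵥ 0ᵥ
      ≡⟨ +ᵥ-identityʳ _ ⟩
    b • (N^ j · u) ∎

  -- The leading coefficients agree by leading-term; the tails are Krylov
  -- combinations of N u, whose height is one less.
  krylov-injective : ∀ j u → N^ (suc j) · u ≡ 0ᵥ → ¬ N^ j · u ≡ 0ᵥ →
                     (c c' : Vec F₂ (suc j)) → krylov c u ≡ krylov c' u → c ≡ c'
  krylov-injective-tail : ∀ j u → N^ (suc j) · u ≡ 0ᵥ → ¬ N^ j · u ≡ 0ᵥ →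
                          (c c' : Vec F₂ j) → krylov c (N ·ᵥ u) ≡ krylov c' (N ·ᵥ u) → c ≡ c'

  krylov-injective j u vanish nonzero (b ∷ c) (b' ∷ c') same with b Bool.≟ b'
  ... | yes refl = cong (b ∷_) (krylov-injective-tail j u vanish nonzero c c' (+ᵥ-cancelˡ (b • u) same))
  ... | no b≢b'  = contradiction (•-distinct b≢b' (N^ j · u) (begin
        b • (N^ j · u)              ≡⟨ sym (leading-term j vanish b c) ⟩
        N^ j · krylov (b ∷ c) u     ≡⟨ cong (N^ j ·_) same ⟩
        N^ j · krylov (b' ∷ c') u   ≡⟨ leading-term j vanish b' c' ⟩
        b' • (N^ j · u)             ∎)) nonzero

  krylov-injective-tail zero u _ _ [] [] _ = refl
  krylov-injective-tail (suc j) u vanish nonzero c c' same =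
    krylov-injective j (N ·ᵥ u) (trans (N^-shift (suc j) u) vanish)
                     (λ Nʲ⁺¹u≡0 → nonzero (trans (sym (N^-shift j u)) Nʲ⁺¹u≡0)) c c' same

  exact-height : ∀ s m v → N^ m · v ≡ 0ᵥ → ¬ N^ s · v ≡ 0ᵥ →
                 Σ (Vect r) λ u → (N^ (suc s) · u ≡ 0ᵥ) × ¬ (N^ s · u ≡ 0ᵥ)
  exact-height s zero v vanish nonzero =
    contradiction (trans (cong (N^ s ·_) (trans (sym (Iₘ-·ᵥ v)) vanish)) (·ᵥ-zero (N ^ₘ s))) nonzero
  exact-height s (suc m) v vanish nonzero with ≡-dec Bool._≟_ (N^ (suc s) · v) 0ᵥ
  ... | yes Nˢ⁺¹v≡0 = v , Nˢ⁺¹v≡0 , nonzero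
  ... | no Nˢ⁺¹v≢0 = exact-height s m (N ·ᵥ v) (trans (N^-shift m v) vanish)
                                  (λ Nˢ[Nv]≡0 → Nˢ⁺¹v≢0 (trans (sym (N^-shift s v)) Nˢ[Nv]≡0))

  nilpotent-index : ∀ m → N ^ₘ m ≡ 0ₘ → N ^ₘ r ≡ 0ₘ
  nilpotent-index m Nᵐ≡0 = action-ext (λ v → trans (kills v) (sym (0ₘ-·ᵥ v)))
    where
    kills : ∀ v → N^ r · v ≡ 0ᵥ
    kills v with ≡-dec Bool._≟_ (N^ r · v) 0ᵥ
    ... | yes Nʳv≡0 = Nʳv≡0
    ... | no Nʳv≢0 with exact-height r m v (trans (cong (_·ᵥ v) Nᵐ≡0) (0ₘ-·ᵥ v)) Nʳv≢0
    ... | u , vanish , nonzero with vec-pigeonhole (λ c → krylov c u)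
    ... | c , c' , c≢c' , same = contradiction (krylov-injective r u vanish nonzero c c' same) c≢c'

open Krylov using (nilpotent-index)

unipotent-index : ∀ {r} (A : Mat r) l → A ^ₘ (2 ^ l) ≡ Iₘ → (Iₘ +ₘ A) ^ₘ r ≡ 0ₘ
unipotent-index A l A²ˡ≡I = nilpotent-index (Iₘ +ₘ A) (2 ^ l) (unipotent A l A²ˡ≡I)

module _ {X : Set} (_≟_ : DecidableEquality X) where
  open import Data.List.Membership.DecPropositional _≟_ using (_∈?_)

  split-length : ∀ {O ys : List X} → Unique O → Unique ys → (∀ {z} → z ∈ O → z ∈ ys) →
                 length ys ≡ length O + length (filter (λ z → ¬? (z ∈? O)) ys)
  split-length {O} {ys} O! ys! O⊆ys =
    trans (↭-length (∼bag⇒↭ (unique∧set⇒bag ys! (++⁺ O! (filter⁺ ∉O? ys!) disjoint) same-elements)))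
          (length-++ O)
    where
    ∉O? : (z : X) → Dec (¬ z ∈ O)
    ∉O? z = ¬? (z ∈? O)
    disjoint : ∀ {z} → ¬ (z ∈ O × z ∈ filter ∉O? ys)
    disjoint (z∈O , z∈rest) = proj₂ (∈-filter⁻ ∉O? {xs = ys} z∈rest) z∈O
    same-elements : ∀ {z} → z ∈ ys ⇔ z ∈ O ++ filter ∉O? ys
    same-elements {z} = mk⇔ into (λ z∈O++rest → [ O⊆ys , rest⊆ys ]′ (∈-++⁻ O z∈O++rest))
      where
      into : z ∈ ys → z ∈ O ++ filter ∉O? ys
      into z∈ys with z ∈? O
      ... | yes z∈O = ∈-++⁺ˡ z∈O
      ... | no z∉O  = ∈-++⁺ʳ O (∈-filter⁺ ∉O? z∈ys z∉O)
      rest⊆ys : z ∈ filter ∉O? ys → z ∈ ys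
      rest⊆ys z∈rest = proj₁ (∈-filter⁻ ∉O? {xs = ys} z∈rest)

module _ {X : Set} where
  open import Function.Endo.Propositional X using (^-homo) renaming (_^_ to _^ᵉ_)

  -- Each orbit of a point
  -- of S has exactly n elements, so n divides the size of every finite
  -- φ-invariant subset of S.
  module FreeCyclicAction (_≟_ : DecidableEquality X) (φ : X → X) (n-1 : ℕ) (S : X → Set)
    (periodic : ∀ x → (φ ^ᵉ suc n-1) x ≡ x)
    (free : ∀ {x} → S x → ∀ m → 0 < m → m < suc n-1 → ¬ (φ ^ᵉ m) x ≡ x) where

    n : ℕ
    n = suc n-1

    iterate-+ : ∀ k l x → (φ ^ᵉ (k + l)) x ≡ (φ ^ᵉ k) ((φ ^ᵉ l) x)
    iterate-+ k l x = cong-app (^-homo φ k l) x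

    -- φ is injective, with inverse φ^(n-1).
    φ-injective : ∀ {y z} → φ y ≡ φ z → y ≡ z
    φ-injective {y} {z} φy≡φz = begin
      y                       ≡⟨ sym (periodic y) ⟩
      (φ ^ᵉ suc n-1) y        ≡⟨ unwind y ⟩
      (φ ^ᵉ n-1) (φ y)        ≡⟨ cong (φ ^ᵉ n-1) φy≡φz ⟩
      (φ ^ᵉ n-1) (φ z)        ≡⟨ sym (unwind z) ⟩
      (φ ^ᵉ suc n-1) z        ≡⟨ periodic z ⟩
      z                       ∎
      where
      unwind : ∀ x → (φ ^ᵉ suc n-1) x ≡ (φ ^ᵉ n-1) (φ x)
      unwind x = trans (cong (λ k → (φ ^ᵉ k) x) (ℕ.+-comm 1 n-1)) (iterate-+ n-1 1 x)

    iterate-injective : ∀ k {y z} → (φ ^ᵉ k) y ≡ (φ ^ᵉ k) z → y ≡ z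
    iterate-injective zero    eq = eq
    iterate-injective (suc k) eq = iterate-injective k (φ-injective eq)

    orbit : X → List X
    orbit x = List.tabulate {n = n} (λ i → (φ ^ᵉ toℕ i) x)

    ∈-orbit⁺ : ∀ x {k} → k < n → (φ ^ᵉ k) x ∈ orbit x
    ∈-orbit⁺ x {k} k<n = subst (λ j → (φ ^ᵉ j) x ∈ orbit x) (toℕ-fromℕ< k<n)
                               (∈-tabulate⁺ {f = λ i → (φ ^ᵉ toℕ i) x} (fromℕ< k<n))

    ∈-orbit⁻ : ∀ x {z} → z ∈ orbit x → Σ ℕ λ k → k < n × z ≡ (φ ^ᵉ k) x
    ∈-orbit⁻ x z∈O with ∈-tabulate⁻ z∈O
    ... | i , z≡φⁱx = toℕ i , toℕ<n i , z≡φⁱx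

    orbit-unique : ∀ {x} → S x → Unique (orbit x)
    orbit-unique {x} x∈S = tabulate⁺ injective
      where
      no-collision : ∀ {a b} → a < b → b < n → ¬ (φ ^ᵉ a) x ≡ (φ ^ᵉ b) x
      no-collision {a} {b} a<b b<n φᵃx≡φᵇx =
        free x∈S (b ∸ a) (ℕ.m<n⇒0<n∸m a<b) (ℕ.≤-<-trans (ℕ.m∸n≤m b a) b<n)
             (sym (iterate-injective a (begin
               (φ ^ᵉ a) x                  ≡⟨ φᵃx≡φᵇx ⟩
               (φ ^ᵉ b) x                  ≡⟨ cong (λ k → (φ ^ᵉ k) x) (sym (ℕ.m+[n∸m]≡n (ℕ.<⇒≤ a<b))) ⟩
               (φ ^ᵉ (a + (b ∸ a))) x      ≡⟨ iterate-+ a (b ∸ a) x ⟩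
               (φ ^ᵉ a) ((φ ^ᵉ (b ∸ a)) x) ∎)))
      injective : ∀ {i j : Fin n} → (φ ^ᵉ toℕ i) x ≡ (φ ^ᵉ toℕ j) x → i ≡ j
      injective {i} {j} eq with ℕ.<-cmp (toℕ i) (toℕ j)
      ... | tri< i<j _ _ = contradiction eq (no-collision i<j (toℕ<n j))
      ... | tri≈ _ i≡j _ = toℕ-injective i≡j
      ... | tri> _ _ j<i = contradiction (sym eq) (no-collision j<i (toℕ<n i))

    orbit-closed⁻ : ∀ x {z} → φ z ∈ orbit x → z ∈ orbit x
    orbit-closed⁻ x {z} φz∈O with ∈-orbit⁻ x φz∈O
    ... | suc k , k<n , φz≡φᵏ⁺¹x =
      subst (_∈ orbit x) (sym (φ-injective φz≡φᵏ⁺¹x)) (∈-orbit⁺ x (ℕ.<-trans (ℕ.n<1+n k) k<n))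
    ... | zero  , _   , φz≡x    =
      subst (_∈ orbit x) (sym (φ-injective (trans φz≡x (sym (periodic x))))) (∈-orbit⁺ x (ℕ.n<1+n n-1))

    iterate-closed : ∀ {ys} → (∀ {y} → y ∈ ys → φ y ∈ ys) → ∀ {x} → x ∈ ys → ∀ k → (φ ^ᵉ k) x ∈ ys
    iterate-closed closed x∈ys zero    = x∈ys
    iterate-closed closed x∈ys (suc k) = closed (iterate-closed closed x∈ys k)

    -- Removing the orbit of the first point leaves a smaller closed subset of S.
    orbits-divide : ∀ ys → Unique ys → (∀ {y} → y ∈ ys → S y) → (∀ {y} → y ∈ ys → φ y ∈ ys) →
                    n ∣ length ys
    orbits-divide ys = go ys (<-wellFounded (length ys))
      where
      open import Data.List.Membership.DecPropositional _≟_ using (_∈?_)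
      go : ∀ ys → Acc _<_ (length ys) → Unique ys → (∀ {y} → y ∈ ys → S y) →
           (∀ {y} → y ∈ ys → φ y ∈ ys) → n ∣ length ys
      go [] _ _ _ _ = n ∣0
      go ys@(x ∷ _) (acc smaller) ys! ys⊆S closed =
        subst (n ∣_) (sym split) (∣m∣n⇒∣m+n ∣-refl (go rest (smaller shorter) rest! rest⊆S rest-closed))
        where
        ∉orbit? : (z : X) → Dec (¬ z ∈ orbit x)
        ∉orbit? z = ¬? (z ∈? orbit x)
        rest : List X
        rest = filter ∉orbit? ys
        orbit⊆ys : ∀ {z} → z ∈ orbit x → z ∈ ys
        orbit⊆ys z∈O with ∈-orbit⁻ x z∈O
        ... | k , _ , refl = iterate-closed closed (here refl) k
        split : length ys ≡ n + length rest
        split = trans (split-length _≟_ (orbit-unique (ys⊆S (here refl))) ys! orbit⊆ys)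
                      (cong (_+ length rest) (length-tabulate (λ i → (φ ^ᵉ toℕ i) x)))
        shorter : length rest < length ys
        shorter = subst (length rest <_) (sym split) (ℕ.m<n+m (length rest) (s≤s z≤n))
        rest! : Unique rest
        rest! = filter⁺ ∉orbit? ys!
        rest⊆S : ∀ {z} → z ∈ rest → S z
        rest⊆S z∈rest = ys⊆S (proj₁ (∈-filter⁻ ∉orbit? {xs = ys} z∈rest))
        rest-closed : ∀ {z} → z ∈ rest → φ z ∈ rest
        rest-closed z∈rest with ∈-filter⁻ ∉orbit? {xs = ys} z∈rest
        ... | z∈ys , z∉O = ∈-filter⁺ ∉orbit? (closed z∈ys) (λ φz∈O → z∉O (orbit-closed⁻ x φz∈O))

∘ₐ-assoc : ∀ {r} (g h k : Aff r) → (g ∘ₐ h) ∘ₐ k ≡ g ∘ₐ (h ∘ₐ k)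
∘ₐ-assoc (a , A) (b , B) (c , C) = cong₂ _,_ translation (*ₘ-assoc A B C)
  where
  translation : (a +ᵥ (A ·ᵥ b)) +ᵥ ((A *ₘ B) ·ᵥ c) ≡ a +ᵥ (A ·ᵥ (b +ᵥ (B ·ᵥ c)))
  translation = begin
    (a +ᵥ (A ·ᵥ b)) +ᵥ ((A *ₘ B) ·ᵥ c)   ≡⟨ +ᵥ-assoc a (A ·ᵥ b) ((A *ₘ B) ·ᵥ c) ⟩
    a +ᵥ ((A ·ᵥ b) +ᵥ ((A *ₘ B) ·ᵥ c))   ≡⟨ cong (λ v → a +ᵥ ((A ·ᵥ b) +ᵥ v)) (*ₘ-·ᵥ A B c) ⟩
    a +ᵥ ((A ·ᵥ b) +ᵥ (A ·ᵥ (B ·ᵥ c)))   ≡⟨ cong (a +ᵥ_) (sym (·ᵥ-distrib A b (B ·ᵥ c))) ⟩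
    a +ᵥ (A ·ᵥ (b +ᵥ (B ·ᵥ c)))          ∎

∘ₐ-identityˡ : ∀ {r} (g : Aff r) → eₐ ∘ₐ g ≡ g
∘ₐ-identityˡ (b , B) = cong₂ _,_ (trans (+ᵥ-identityˡ (Iₘ ·ᵥ b)) (Iₘ-·ᵥ b)) (*ₘ-identityˡ B)

∘ₐ-identityʳ : ∀ {r} (g : Aff r) → g ∘ₐ eₐ ≡ g
∘ₐ-identityʳ (a , A) = cong₂ _,_ (trans (cong (a +ᵥ_) (·ᵥ-zero A)) (+ᵥ-identityʳ a)) (*ₘ-identityʳ A)

^ₐ-+ : ∀ {r} (g : Aff r) m n → g ^ₐ (m + n) ≡ (g ^ₐ m) ∘ₐ (g ^ₐ n)
^ₐ-+ g zero n = sym (∘ₐ-identityˡ _)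
^ₐ-+ g (suc m) n = trans (cong (g ∘ₐ_) (^ₐ-+ g m n)) (sym (∘ₐ-assoc g (g ^ₐ m) (g ^ₐ n)))

linear-part : ∀ {r} (a : Vect r) (A : Mat r) n → proj₂ ((a , A) ^ₐ n) ≡ A ^ₘ n
linear-part a A zero    = refl
linear-part a A (suc n) = cong (A *ₘ_) (linear-part a A n)

square-affine : ∀ {r} (b : Vect r) (B : Mat r) → (b , B) ∘ₐ (b , B) ≡ ((Iₘ +ₘ B) ·ᵥ b , B *ₘ B)
square-affine b B = cong (_, B *ₘ B) (sym (trans (+ₘ-·ᵥ Iₘ B b) (cong (_+ᵥ (B ·ᵥ b)) (Iₘ-·ᵥ b))))

power-of-two : ∀ {r} (a : Vect r) (A : Mat r) k →
               (a , A) ^ₐ (2 ^ k) ≡ (((Iₘ +ₘ A) ^ₘ (2 ^ k ∸ 1)) ·ᵥ a , A ^ₘ (2 ^ k))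
power-of-two a A zero =
  cong (_, A *ₘ Iₘ) (trans (cong (a +ᵥ_) (·ᵥ-zero A)) (trans (+ᵥ-identityʳ a) (sym (Iₘ-·ᵥ a))))
power-of-two {r} a A (suc k) = begin
  g ^ₐ (2 * 2 ^ k)
    ≡⟨ trans (cong (λ e → g ^ₐ (2 ^ k + e)) (ℕ.+-identityʳ (2 ^ k))) (^ₐ-+ g (2 ^ k) (2 ^ k)) ⟩
  (g ^ₐ (2 ^ k)) ∘ₐ (g ^ₐ (2 ^ k))
    ≡⟨ cong (λ h → h ∘ₐ h) (power-of-two a A k) ⟩
  ((N ^ₘ p) ·ᵥ a , B) ∘ₐ ((N ^ₘ p) ·ᵥ a , B)
    ≡⟨ square-affine ((N ^ₘ p) ·ᵥ a) B ⟩
  ((Iₘ +ₘ B) ·ᵥ ((N ^ₘ p) ·ᵥ a) , B *ₘ B)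
    ≡⟨ cong₂ _,_ translation (sym (^ₘ-double A (2 ^ k))) ⟩
  ((N ^ₘ (2 * 2 ^ k ∸ 1)) ·ᵥ a , A ^ₘ (2 * 2 ^ k)) ∎
  where
  g : Aff r
  g = (a , A)
  N B : Mat r
  N = Iₘ +ₘ A
  B = A ^ₘ (2 ^ k)
  p : ℕ
  p = 2 ^ k ∸ 1
  exponent : 2 ^ k + p ≡ 2 * 2 ^ k ∸ 1
  exponent = sym (trans (ℕ.+-∸-assoc (2 ^ k) (ℕ.≤-trans (ℕ.m^n>0 2 k) (ℕ.m≤m+n (2 ^ k) 0)))
                        (cong (λ e → 2 ^ k + (e ∸ 1)) (ℕ.+-identityʳ (2 ^ k))))
  translation : (Iₘ +ₘ B) ·ᵥ ((N ^ₘ p) ·ᵥ a) ≡ (N ^ₘ (2 * 2 ^ k ∸ 1)) ·ᵥ a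
  translation = begin
    (Iₘ +ₘ B) ·ᵥ ((N ^ₘ p) ·ᵥ a)        ≡⟨ cong (_·ᵥ ((N ^ₘ p) ·ᵥ a)) (sym (frobenius A k)) ⟩
    (N ^ₘ (2 ^ k)) ·ᵥ ((N ^ₘ p) ·ᵥ a)   ≡⟨ sym (*ₘ-·ᵥ (N ^ₘ (2 ^ k)) (N ^ₘ p) a) ⟩
    ((N ^ₘ (2 ^ k)) *ₘ (N ^ₘ p)) ·ᵥ a   ≡⟨ cong (_·ᵥ a) (sym (^ₘ-+ N (2 ^ k) p)) ⟩
    (N ^ₘ (2 ^ k + p)) ·ᵥ a             ≡⟨ cong (λ e → (N ^ₘ e) ·ᵥ a) exponent ⟩
    (N ^ₘ (2 * 2 ^ k ∸ 1)) ·ᵥ a         ∎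

power-of-two-trivial : ∀ {r} (a : Vect r) (A : Mat r) → (Iₘ +ₘ A) ^ₘ r ≡ 0ₘ →
                       ∀ k → r < 2 ^ k → (a , A) ^ₐ (2 ^ k) ≡ eₐ
power-of-two-trivial a A Nʳ≡0 k r<2ᵏ = trans (power-of-two a A k) (cong₂ _,_ translation linear)
  where
  translation : ((Iₘ +ₘ A) ^ₘ (2 ^ k ∸ 1)) ·ᵥ a ≡ 0ᵥ
  translation = trans (cong (_·ᵥ a) (^ₘ-vanishes (Iₘ +ₘ A) Nʳ≡0 (ℕ.∸-monoˡ-≤ 1 r<2ᵏ))) (0ₘ-·ᵥ a)
  linear : A ^ₘ (2 ^ k) ≡ Iₘ
  linear = sym (+ₘ≡0⇒≡ (trans (sym (frobenius A k)) (^ₘ-vanishes (Iₘ +ₘ A) Nʳ≡0 (ℕ.<⇒≤ r<2ᵏ))))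

-- Lagrange's theorem for cyclic subgroups: the order of an element g of a
-- finite subgroup H of GA(r,2) divides |H|, because left multiplication by
-- g generates a free cyclic action on H.
order-divides : ∀ {r} {H : Aff r → Set} {c} → IsSubgroupGA H → HasCard H c →
                ∀ {g} → H g → ∀ {n} → HasOrderAff g n → n ∣ c
order-divides {r} {H} (_ , _ , closed , inverse) (xs , xs! , refl , members) {g} g∈H {suc n-1}
              (_ , gⁿ≡e , minimal) =
  Action.orbits-divide xs xs! (λ {y} → from (members y)) xs-closed
  where
  open import Function.Endo.Propositional (Aff r) using () renaming (_^_ to _^ᵉ_)
  open Equivalence using (to; from)

  _≟ₐ_ : DecidableEquality (Aff r)
  _≟ₐ_ = ×-≟ (≡-dec Bool._≟_) (≡-dec (≡-dec Bool._≟_))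

  left-mult : ∀ k x → ((g ∘ₐ_) ^ᵉ k) x ≡ (g ^ₐ k) ∘ₐ x
  left-mult zero    x = sym (∘ₐ-identityˡ x)
  left-mult (suc k) x = trans (cong (g ∘ₐ_) (left-mult k x)) (sym (∘ₐ-assoc g (g ^ₐ k) x))

  periodic : ∀ x → ((g ∘ₐ_) ^ᵉ suc n-1) x ≡ x
  periodic x = trans (left-mult (suc n-1) x) (trans (cong (_∘ₐ x) gⁿ≡e) (∘ₐ-identityˡ x))

  -- g^m x = x with x invertible forces g^m = e.
  free : ∀ {x} → H x → ∀ m → 0 < m → m < suc n-1 → ¬ ((g ∘ₐ_) ^ᵉ m) x ≡ x
  free {x} x∈H m 0<m m<n gᵐx≡x with inverse x x∈H
  ... | x⁻¹ , _ , x∘x⁻¹≡e , _ = minimal m 0<m m<n (begin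
    g ^ₐ m                     ≡⟨ sym (∘ₐ-identityʳ (g ^ₐ m)) ⟩
    (g ^ₐ m) ∘ₐ eₐ             ≡⟨ cong ((g ^ₐ m) ∘ₐ_) (sym x∘x⁻¹≡e) ⟩
    (g ^ₐ m) ∘ₐ (x ∘ₐ x⁻¹)     ≡⟨ sym (∘ₐ-assoc (g ^ₐ m) x x⁻¹) ⟩
    ((g ^ₐ m) ∘ₐ x) ∘ₐ x⁻¹     ≡⟨ cong (_∘ₐ x⁻¹) (trans (sym (left-mult m x)) gᵐx≡x) ⟩
    x ∘ₐ x⁻¹                   ≡⟨ x∘x⁻¹≡e ⟩
    eₐ                         ∎)

  module Action = FreeCyclicAction _≟ₐ_ (g ∘ₐ_) n-1 H periodic free

  xs-closed : ∀ {y} → y ∈ xs → g ∘ₐ y ∈ xs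
  xs-closed {y} y∈xs = to (members (g ∘ₐ y)) (closed g y g∈H (from (members y) y∈xs))

order-≤ : ∀ {r} {g : Aff r} {n K} → HasOrderAff g n → 0 < K → g ^ₐ K ≡ eₐ → n ≤ K
order-≤ (_ , _ , minimal) 0<K gᴷ≡e = ℕ.≮⇒≥ (λ K<n → minimal _ 0<K K<n gᴷ≡e)

<2^⌊log₂⌋+1 : ∀ r → r < 2 ^ (⌊log₂ r ⌋ + 1)
<2^⌊log₂⌋+1 r = ℕ.≰⇒> λ 2^[k+1]≤r → ℕ.n≮n ⌊log₂ r ⌋ (subst (_≤ ⌊log₂ r ⌋)
  (trans (⌊log₂[2^n]⌋≡n (⌊log₂ r ⌋ + 1)) (ℕ.+-comm ⌊log₂ r ⌋ 1)) (⌊log₂⌋-mono-≤ 2^[k+1]≤r))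

proposition5 : (r : ℕ) → 1 ≤ r →
    ((A : Mat r) → InGL A → (l : ℕ) → HasOrderMat A (2 ^ l) → (Iₘ +ₘ A) ^ₘ r ≡ 0ₘ)
    × ((H : Aff r → Set) → IsRegularSubgroupGA H →
        (g : Aff r) → H g → (n : ℕ) → HasOrderAff g n → n ≤ 2 ^ (⌊log₂ r ⌋ + 1))
proposition5 r _ = part1 , part2
  where
  part1 : (A : Mat r) → InGL A → (l : ℕ) → HasOrderMat A (2 ^ l) → (Iₘ +ₘ A) ^ₘ r ≡ 0ₘ
  part1 A _ l (_ , A²ˡ≡I , _) = unipotent-index A l A²ˡ≡I

  part2 : (H : Aff r → Set) → IsRegularSubgroupGA H →
          (g : Aff r) → H g → (n : ℕ) → HasOrderAff g n → n ≤ 2 ^ (⌊log₂ r ⌋ + 1)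
  part2 H (subgroup , _ , card) (a , A) g∈H n order@(_ , gⁿ≡e , _) =
    order-≤ order (ℕ.m^n>0 2 (⌊log₂ r ⌋ + 1)) (power-of-two-trivial a A Nʳ≡0 (⌊log₂ r ⌋ + 1) (<2^⌊log₂⌋+1 r))
    where
    Aⁿ≡I : A ^ₘ n ≡ Iₘ
    Aⁿ≡I = trans (sym (linear-part a A n)) (cong proj₂ gⁿ≡e)
    Nʳ≡0 : (Iₘ +ₘ A) ^ₘ r ≡ 0ₘ
    Nʳ≡0 = unipotent-index A r (^ₘ-multiple A Aⁿ≡I (order-divides subgroup card g∈H order))
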